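{- Let $d\ge 2$ and $N\ge d+1$ be integers. The combinatorial diameter of $\partial SC(N, d+1)$ is at least $\frac{d-1}{d}N - d$.
   Context: $SC(N,d+1)$ is the pure $d$-dimensional simplicial complex on vertex set $[N]=\{1,\dots,N\}$ whose facets are $\{i,i+1,\dots,i+d\}$ for $i=1,\dots,N-d$. Its boundary $\partial SC(N,d+1)$ is the pure $(d-1)$-dimensional simplicial complex whose facets are the $(d-1)$-dimensional faces of $SC(N,d+1)$ contained in exactly one facet of $SC(N,d+1)$. The dual graph of a pure complex has its facets as vertices, two facets adjacent if they share a codimension-one face; the combinatorial diameter is the graph diameter of the dual graph. -}

module Defs where

open import Data.Nat using (ℕ; zero; suc; _+_; _*_; _∸_; _≤_; _<_; _≤?_)
open import Data.Bool using (Bool; _∧_)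
open import Data.Fin using (Fin; toℕ)
open import Data.Fin.Subset using (Subset; _⊆_; _∩_; ∣_∣)
open import Data.Vec using (tabulate)
open import Data.Product using (Σ; _×_; proj₁)
open import Relation.Nullary.Decidable using (⌊_⌋)
open import Relation.Binary.PropositionalEquality using (_≡_)

-- Vertices of SC(N,d+1) are Fin N, i.e. 0,…,N-1 (vertex v stands for v+1 ∈ [N]).
-- Faces are subsets of Fin N.

interval : (N i d : ℕ) → Subset N
interval N i d = tabulate (λ v → ⌊ i ≤? toℕ v ⌋ ∧ ⌊ toℕ v ≤? i + d ⌋)

-- i indexes a facet of SC(N,d+1): 0 ≤ i and i + d ≤ N - 1
-- (corresponds to i+1 = 1,…,N-d in the 1-indexed convention).
IsFacetIndex : (N d i : ℕ) → Set
IsFacetIndex N d i = i + d < N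

-- σ is a facet of ∂SC(N,d+1): a (d-1)-dimensional face (d vertices)
-- contained in exactly one facet of SC(N,d+1).
IsBoundaryFacet : (N d : ℕ) → Subset N → Set
IsBoundaryFacet N d σ =
  (∣ σ ∣ ≡ d) ×
  Σ ℕ (λ i → IsFacetIndex N d i × (σ ⊆ interval N i d) ×
     ((j : ℕ) → IsFacetIndex N d j → σ ⊆ interval N j d → j ≡ i))

BFacet : (N d : ℕ) → Set
BFacet N d = Σ (Subset N) (IsBoundaryFacet N d)

-- Adjacency in the dual graph: the two (d-1)-faces share a
-- codimension-one face, i.e. their intersection has d-1 vertices.
Adjacent : (N d : ℕ) → BFacet N d → BFacet N d → Set
Adjacent N d σ τ = ∣ proj₁ σ ∩ proj₁ τ ∣ ≡ d ∸ 1

data Walk (N d : ℕ) : BFacet N d → BFacet N d → ℕ → Set where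
  here : ∀ {σ} → Walk N d σ σ zero
  step : ∀ {σ τ ρ ℓ} → Adjacent N d σ τ → Walk N d τ ρ ℓ → Walk N d σ ρ (suc ℓ)

-- Since distances are integers
-- (or ∞), dist ≥ (d-1)N/d - d  ⇔  (d-1)N ≤ d·dist + d·d  for every walk length.
DiameterAtLeastBound : (N d : ℕ) → Set
DiameterAtLeastBound N d =
  Σ (BFacet N d) λ σ → Σ (BFacet N d) λ τ →
    (ℓ : ℕ) → Walk N d σ τ ℓ → (d ∸ 1) * N ≤ d * ℓ + d * d

module Submission where

-- Give a boundary facet x the potential Ψ(x) = Σ_{t<N} min(#{v ∈ x | v ≥ t}, d − 1).
-- An adjacent boundary facet τ differs from x in one vertex and lies in some
-- facet {j, …, j + d}; for t ≤ j all of τ is ≥ t, so x already reaches the cap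
-- d − 1 there, and for t > j + d the count for τ is 0.  Only the d thresholds
-- in between can grow, each by one, so Ψ rises by at most d per step.  The
-- facets {0, …, d − 1} and {N − d, …, N − 1} differ in Ψ by (N − d)(d − 1),
-- hence every walk between them has length at least (d − 1)(N − d)/d.

open import Defs
open import Data.Nat using (ℕ; zero; suc; _+_; _*_; _∸_; _≤_; _<_; _⊓_; _⊔_; z≤n; s≤s; s≤s⁻¹; z<s)
open import Data.Nat.Properties
open import Algebra.Properties.CommutativeSemigroup +-commutativeSemigroup using (interchange)
open import Data.Bool using (Bool; true; false; T; _∧_; if_then_else_)
open import Data.Bool.Properties using (T-≡; T-∧; ∧-assoc; ∧-comm; ∧-zeroʳ)
open import Data.Fin using (Fin; toℕ; fromℕ)
import Data.Fin as Fin
open import Data.Fin.Properties using (toℕ-fromℕ)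
open import Data.Fin.Subset using (Subset; _⊆_; _∩_; _∪_; ∣_∣; _∈_; ⊥)
open import Data.Fin.Subset.Properties
  using (p⊆q⇒∣p∣≤∣q∣; ∣⊥∣≡0; x∈p∩q⁻; x∈p∩q⁺; x∈p∪q⁻; p∩q⊆p; p∩q⊆q)
open import Data.Vec using (_∷_; []; tabulate)
open import Data.Vec.Properties using (lookup∘tabulate; []=⇒lookup; lookup⇒[]=; tabulate-cong)
open import Data.Product using (_×_; _,_; proj₁; proj₂; uncurry)
open import Data.Sum using (inj₁; inj₂)
open import Data.Empty using (⊥-elim)
open import Function.Bundles using (Equivalence; _⇔_; mk⇔)
open import Relation.Nullary using (yes; no; does; _×-dec_)
open import Relation.Nullary.Decidable using (⌊_⌋; toWitness; fromWitness; does-⇔; isYes≗does)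
open import Relation.Binary.PropositionalEquality

∑< : ℕ → (ℕ → ℕ) → ℕ
∑< zero    f = 0
∑< (suc n) f = ∑< n f + f n

∑<-cong : ∀ n {f g : ℕ → ℕ} → (∀ {t} → t < n → f t ≡ g t) → ∑< n f ≡ ∑< n g
∑<-cong zero    f≡g = refl
∑<-cong (suc n) f≡g = cong₂ _+_ (∑<-cong n (λ t<n → f≡g (m<n⇒m<1+n t<n))) (f≡g (n<1+n n))

∑<-mono-≤ : ∀ n {f g : ℕ → ℕ} → (∀ t → f t ≤ g t) → ∑< n f ≤ ∑< n g
∑<-mono-≤ zero    f≤g = z≤n
∑<-mono-≤ (suc n) f≤g = +-mono-≤ (∑<-mono-≤ n f≤g) (f≤g n)

∑<-+ : ∀ n (f g : ℕ → ℕ) → ∑< n (λ t → f t + g t) ≡ ∑< n f + ∑< n g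
∑<-+ zero    f g = refl
∑<-+ (suc n) f g =
  trans (cong (_+ (f n + g n)) (∑<-+ n f g)) (interchange (∑< n f) (∑< n g) (f n) (g n))

∑<-const : ∀ n c → ∑< n (λ _ → c) ≡ n * c
∑<-const zero    c = refl
∑<-const (suc n) c = trans (cong (_+ c) (∑<-const n c)) (+-comm (n * c) c)

∑<-split : ∀ m n (f : ℕ → ℕ) → ∑< (m + n) f ≡ ∑< m f + ∑< n (λ t → f (m + t))
∑<-split m zero    f = trans (cong (λ k → ∑< k f) (+-identityʳ m)) (sym (+-identityʳ _))
∑<-split m (suc n) f = begin
  ∑< (m + suc n) f                                ≡⟨ cong (λ k → ∑< k f) (+-suc m n) ⟩
  ∑< (m + n) f + f (m + n)                        ≡⟨ cong (_+ f (m + n)) (∑<-split m n f) ⟩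
  ∑< m f + ∑< n (λ t → f (m + t)) + f (m + n)     ≡⟨ +-assoc (∑< m f) _ _ ⟩
  ∑< m f + ∑< (suc n) (λ t → f (m + t))           ∎
  where open ≡-Reasoning

indicator : Bool → ℕ
indicator b = if b then 1 else 0

count : ℕ → (ℕ → Bool) → ℕ
count n P = ∑< n (λ v → indicator (P v))

∣x∷p∣ : ∀ {n} x (p : Subset n) → ∣ x ∷ p ∣ ≡ indicator x + ∣ p ∣
∣x∷p∣ true  p = refl
∣x∷p∣ false p = refl

∣tabulate∣≡count : ∀ n (P : ℕ → Bool) → ∣ tabulate {n = n} (λ v → P (toℕ v)) ∣ ≡ count n P
∣tabulate∣≡count zero    P = refl
∣tabulate∣≡count (suc n) P = begin
  ∣ tabulate {n = suc n} (λ v → P (toℕ v)) ∣      ≡⟨ ∣x∷p∣ (P 0) rest ⟩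
  indicator (P 0) + ∣ rest ∣                       ≡⟨ cong (indicator (P 0) +_) (∣tabulate∣≡count n P∘suc) ⟩
  indicator (P 0) + count n P∘suc                  ≡⟨ ∑<-split 1 n (λ v → indicator (P v)) ⟨
  count (suc n) P                                  ∎
  where
  open ≡-Reasoning
  P∘suc : ℕ → Bool
  P∘suc v = P (suc v)
  rest : Subset n
  rest = tabulate (λ v → P∘suc (toℕ v))

inRange : ℕ → ℕ → ℕ → Bool
inRange a b v = ⌊ a ≤? v ⌋ ∧ ⌊ v ≤? b ⌋

inRange⁺ : ∀ {a b v} → a ≤ v → v ≤ b → T (inRange a b v)
inRange⁺ {a} {b} {v} a≤v v≤b =
  Equivalence.from (T-∧ {⌊ a ≤? v ⌋})
    (fromWitness {a? = a ≤? v} a≤v , fromWitness {a? = v ≤? b} v≤b)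

inRange⁻ : ∀ {a b v} → T (inRange a b v) → a ≤ v × v ≤ b
inRange⁻ {a} {b} {v} h with p , q ← Equivalence.to (T-∧ {⌊ a ≤? v ⌋}) h =
  toWitness {a? = a ≤? v} p , toWitness {a? = v ≤? b} q

count-inRange : ∀ n a b → count n (inRange a b) ≡ (n ⊓ suc b) ∸ a
count-inRange zero    a b = sym (0∸n≡0 a)
count-inRange (suc n) a b rewrite count-inRange n a b with a ≤? n | n ≤? b
... | yes a≤n | yes n≤b
  rewrite m≤n⇒m⊓n≡m n≤b | m≤n⇒m⊓n≡m (m≤n⇒m≤1+n n≤b) =
    trans (sym (+-∸-comm 1 a≤n)) (cong (_∸ a) (+-comm n 1))
... | no a≰n  | yes n≤b
  rewrite m≤n⇒m⊓n≡m n≤b | m≤n⇒m⊓n≡m (m≤n⇒m≤1+n n≤b) =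
    trans (+-identityʳ _) (trans (m≤n⇒m∸n≡0 (<⇒≤ (≰⇒> a≰n))) (sym (m≤n⇒m∸n≡0 (≰⇒> a≰n))))
... | a?      | no n≰b
  rewrite m≥n⇒m⊓n≡n (≰⇒> n≰b) | m≥n⇒m⊓n≡n (<⇒≤ (≰⇒> n≰b)) | ∧-zeroʳ ⌊ a? ⌋ = +-identityʳ _

count-inRange-≤ : ∀ n a b → count n (inRange a b) ≤ suc b ∸ a
count-inRange-≤ n a b = ≤-trans (≤-reflexive (count-inRange n a b)) (∸-monoˡ-≤ a (m⊓n≤n n (suc b)))

⌊≤?⌋∧⌊≤?⌋≡⌊⊔≤?⌋ : ∀ a t v → ⌊ a ≤? v ⌋ ∧ ⌊ t ≤? v ⌋ ≡ ⌊ a ⊔ t ≤? v ⌋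
⌊≤?⌋∧⌊≤?⌋≡⌊⊔≤?⌋ a t v = begin
  ⌊ a ≤? v ⌋ ∧ ⌊ t ≤? v ⌋           ≡⟨ cong₂ _∧_ (isYes≗does (a ≤? v)) (isYes≗does (t ≤? v)) ⟩
  does ((a ≤? v) ×-dec (t ≤? v))    ≡⟨ does-⇔ lub⇔ ((a ≤? v) ×-dec (t ≤? v)) (a ⊔ t ≤? v) ⟩
  does (a ⊔ t ≤? v)                 ≡⟨ isYes≗does (a ⊔ t ≤? v) ⟨
  ⌊ a ⊔ t ≤? v ⌋                    ∎
  where
  open ≡-Reasoning
  lub⇔ : (a ≤ v × t ≤ v) ⇔ (a ⊔ t ≤ v)
  lub⇔ = mk⇔ (uncurry ⊔-lub) (λ h → m⊔n≤o⇒m≤o a t h , m⊔n≤o⇒n≤o a t h)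

inRange-∧-≤? : ∀ a b t v → inRange a b v ∧ ⌊ t ≤? v ⌋ ≡ inRange (a ⊔ t) b v
inRange-∧-≤? a b t v = begin
  (⌊ a ≤? v ⌋ ∧ ⌊ v ≤? b ⌋) ∧ ⌊ t ≤? v ⌋ ≡⟨ ∧-assoc ⌊ a ≤? v ⌋ _ _ ⟩
  ⌊ a ≤? v ⌋ ∧ (⌊ v ≤? b ⌋ ∧ ⌊ t ≤? v ⌋) ≡⟨ cong (⌊ a ≤? v ⌋ ∧_) (∧-comm ⌊ v ≤? b ⌋ _) ⟩
  ⌊ a ≤? v ⌋ ∧ (⌊ t ≤? v ⌋ ∧ ⌊ v ≤? b ⌋) ≡⟨ ∧-assoc ⌊ a ≤? v ⌋ _ _ ⟨
  (⌊ a ≤? v ⌋ ∧ ⌊ t ≤? v ⌋) ∧ ⌊ v ≤? b ⌋ ≡⟨ cong (_∧ ⌊ v ≤? b ⌋) (⌊≤?⌋∧⌊≤?⌋≡⌊⊔≤?⌋ a t v) ⟩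
  ⌊ a ⊔ t ≤? v ⌋ ∧ ⌊ v ≤? b ⌋           ∎
  where open ≡-Reasoning

∈-tabulate⁺ : ∀ {n} (f : Fin n → Bool) {x} → T (f x) → x ∈ tabulate f
∈-tabulate⁺ f {x} fx =
  lookup⇒[]= x (tabulate f) (trans (lookup∘tabulate f x) (Equivalence.to T-≡ fx))

∈-tabulate⁻ : ∀ {n} (f : Fin n → Bool) {x} → x ∈ tabulate f → T (f x)
∈-tabulate⁻ f {x} x∈f = Equivalence.from T-≡ (trans (sym (lookup∘tabulate f x)) ([]=⇒lookup x∈f))

∩-tabulate : ∀ {n} (f g : Fin n → Bool) → tabulate f ∩ tabulate g ≡ tabulate (λ v → f v ∧ g v)
∩-tabulate {zero}  f g = refl
∩-tabulate {suc n} f g =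
  cong (f Fin.zero ∧ g Fin.zero ∷_) (∩-tabulate (λ v → f (Fin.suc v)) (λ v → g (Fin.suc v)))

∈-interval⁺ : ∀ {N i e} {x : Fin N} → i ≤ toℕ x → toℕ x ≤ i + e → x ∈ interval N i e
∈-interval⁺ {i = i} {e} i≤x x≤i+e =
  ∈-tabulate⁺ (λ v → inRange i (i + e) (toℕ v)) (inRange⁺ i≤x x≤i+e)

∈-interval⁻ : ∀ {N i e} {x : Fin N} → x ∈ interval N i e → i ≤ toℕ x × toℕ x ≤ i + e
∈-interval⁻ {i = i} {e} x∈ = inRange⁻ (∈-tabulate⁻ (λ v → inRange i (i + e) (toℕ v)) x∈)

∣interval∣ : ∀ N a e → ∣ interval N a e ∣ ≡ (N ⊓ suc (a + e)) ∸ a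
∣interval∣ N a e = trans (∣tabulate∣≡count N (inRange a (a + e))) (count-inRange N a (a + e))

atLeast : (N t : ℕ) → Subset N
atLeast N t = tabulate (λ v → ⌊ t ≤? toℕ v ⌋)

∈-atLeast⁻ : ∀ {N t} {x : Fin N} → x ∈ atLeast N t → t ≤ toℕ x
∈-atLeast⁻ {t = t} {x} x∈ = toWitness {a? = t ≤? toℕ x} (∈-tabulate⁻ (λ v → ⌊ t ≤? toℕ v ⌋) x∈)

∈-atLeast⁺ : ∀ {N t} {x : Fin N} → t ≤ toℕ x → x ∈ atLeast N t
∈-atLeast⁺ {t = t} {x} t≤x = ∈-tabulate⁺ (λ v → ⌊ t ≤? toℕ v ⌋) (fromWitness {a? = t ≤? toℕ x} t≤x)

∣_∩≥_∣ : ∀ {N} → Subset N → ℕ → ℕ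
∣_∩≥_∣ {N} x t = ∣ x ∩ atLeast N t ∣

∣interval∩≥∣ : ∀ N a e t → ∣ interval N a e ∩≥ t ∣ ≡ (N ⊓ suc (a + e)) ∸ (a ⊔ t)
∣interval∩≥∣ N a e t = begin
  ∣ interval N a e ∩ atLeast N t ∣
    ≡⟨ cong (∣_∣ {n = N}) (∩-tabulate (λ v → inRange a (a + e) (toℕ v)) (λ v → ⌊ t ≤? toℕ v ⌋)) ⟩
  ∣ tabulate {n = N} (λ v → inRange a (a + e) (toℕ v) ∧ ⌊ t ≤? toℕ v ⌋) ∣
    ≡⟨ cong (∣_∣ {n = N}) (tabulate-cong (λ v → inRange-∧-≤? a (a + e) t (toℕ v))) ⟩
  ∣ tabulate {n = N} (λ v → inRange (a ⊔ t) (a + e) (toℕ v)) ∣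
    ≡⟨ ∣tabulate∣≡count N (inRange (a ⊔ t) (a + e)) ⟩
  count N (inRange (a ⊔ t) (a + e))
    ≡⟨ count-inRange N (a ⊔ t) (a + e) ⟩
  (N ⊓ suc (a + e)) ∸ (a ⊔ t) ∎
  where open ≡-Reasoning

∣p∪q∣+∣p∩q∣≡∣p∣+∣q∣ : ∀ {n} (p q : Subset n) → ∣ p ∪ q ∣ + ∣ p ∩ q ∣ ≡ ∣ p ∣ + ∣ q ∣
∣p∪q∣+∣p∩q∣≡∣p∣+∣q∣ []          []          = refl
∣p∪q∣+∣p∩q∣≡∣p∣+∣q∣ (true  ∷ p) (true  ∷ q) =
  cong suc (trans (+-suc ∣ p ∪ q ∣ ∣ p ∩ q ∣)
                  (trans (cong suc (∣p∪q∣+∣p∩q∣≡∣p∣+∣q∣ p q)) (sym (+-suc ∣ p ∣ ∣ q ∣))))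
∣p∪q∣+∣p∩q∣≡∣p∣+∣q∣ (true  ∷ p) (false ∷ q) = cong suc (∣p∪q∣+∣p∩q∣≡∣p∣+∣q∣ p q)
∣p∪q∣+∣p∩q∣≡∣p∣+∣q∣ (false ∷ p) (true  ∷ q) =
  trans (cong suc (∣p∪q∣+∣p∩q∣≡∣p∣+∣q∣ p q)) (sym (+-suc ∣ p ∣ ∣ q ∣))
∣p∪q∣+∣p∩q∣≡∣p∣+∣q∣ (false ∷ p) (false ∷ q) = ∣p∪q∣+∣p∩q∣≡∣p∣+∣q∣ p q

∣τ∩q∣+∣σ∩τ∣≤∣τ∣+∣σ∩q∣ : ∀ {n} (σ τ q : Subset n) → ∣ τ ∩ q ∣ + ∣ σ ∩ τ ∣ ≤ ∣ τ ∣ + ∣ σ ∩ q ∣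
∣τ∩q∣+∣σ∩τ∣≤∣τ∣+∣σ∩q∣ σ τ q = begin
  ∣ τ ∩ q ∣ + ∣ σ ∩ τ ∣                           ≡⟨ ∣p∪q∣+∣p∩q∣≡∣p∣+∣q∣ (τ ∩ q) (σ ∩ τ) ⟨
  ∣ (τ ∩ q) ∪ (σ ∩ τ) ∣ + ∣ (τ ∩ q) ∩ (σ ∩ τ) ∣   ≤⟨ +-mono-≤ (p⊆q⇒∣p∣≤∣q∣ ∪⊆τ) (p⊆q⇒∣p∣≤∣q∣ ∩⊆σ∩q) ⟩
  ∣ τ ∣ + ∣ σ ∩ q ∣                                ∎
  where
  open ≤-Reasoning
  ∪⊆τ : (τ ∩ q) ∪ (σ ∩ τ) ⊆ τ
  ∪⊆τ x∈ with x∈p∪q⁻ (τ ∩ q) (σ ∩ τ) x∈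
  ... | inj₁ x∈τ∩q = p∩q⊆p τ q x∈τ∩q
  ... | inj₂ x∈σ∩τ = p∩q⊆q σ τ x∈σ∩τ
  ∩⊆σ∩q : (τ ∩ q) ∩ (σ ∩ τ) ⊆ σ ∩ q
  ∩⊆σ∩q x∈ with x∈τ∩q , x∈σ∩τ ← x∈p∩q⁻ (τ ∩ q) (σ ∩ τ) x∈ =
    x∈p∩q⁺ (p∩q⊆p σ τ x∈σ∩τ , p∩q⊆q τ q x∈τ∩q)

∣∩≥∣-adjacent : ∀ {N k} {σ τ : Subset N} → ∣ τ ∣ ≡ suc k → ∣ σ ∩ τ ∣ ≡ k →
                ∀ t → ∣ τ ∩≥ t ∣ ≤ suc ∣ σ ∩≥ t ∣
∣∩≥∣-adjacent {N} {k} {σ} {τ} ∣τ∣≡1+k ∣σ∩τ∣≡k t = +-cancelʳ-≤ k _ _ (begin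
  ∣ τ ∩≥ t ∣ + k                       ≡⟨ cong (∣ τ ∩≥ t ∣ +_) ∣σ∩τ∣≡k ⟨
  ∣ τ ∩≥ t ∣ + ∣ σ ∩ τ ∣               ≤⟨ ∣τ∩q∣+∣σ∩τ∣≤∣τ∣+∣σ∩q∣ σ τ (atLeast N t) ⟩
  ∣ τ ∣ + ∣ σ ∩≥ t ∣                   ≡⟨ cong (_+ ∣ σ ∩≥ t ∣) ∣τ∣≡1+k ⟩
  suc (k + ∣ σ ∩≥ t ∣)                 ≡⟨ cong suc (+-comm k ∣ σ ∩≥ t ∣) ⟩
  suc ∣ σ ∩≥ t ∣ + k                   ∎)
  where open ≤-Reasoning

∣∩≥∣-below : ∀ {N j e t} {τ : Subset N} → τ ⊆ interval N j e → t ≤ j → ∣ τ ∣ ≤ ∣ τ ∩≥ t ∣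
∣∩≥∣-below τ⊆ t≤j = p⊆q⇒∣p∣≤∣q∣ λ x∈τ →
  x∈p∩q⁺ (x∈τ , ∈-atLeast⁺ (≤-trans t≤j (proj₁ (∈-interval⁻ (τ⊆ x∈τ)))))

∣∩≥∣-above : ∀ {N j e t} {τ : Subset N} → τ ⊆ interval N j e → j + e < t → ∣ τ ∩≥ t ∣ ≡ 0
∣∩≥∣-above {N} {t = t} {τ} τ⊆ j+e<t = n≤0⇒n≡0 (≤-trans (p⊆q⇒∣p∣≤∣q∣ ∩⊆⊥) (≤-reflexive (∣⊥∣≡0 N)))
  where
  ∩⊆⊥ : τ ∩ atLeast N t ⊆ ⊥
  ∩⊆⊥ x∈ with x∈τ , x≥t ← x∈p∩q⁻ τ (atLeast N t) x∈ =
    ⊥-elim (<⇒≱ j+e<t (≤-trans (∈-atLeast⁻ x≥t) (proj₂ (∈-interval⁻ (τ⊆ x∈τ)))))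

potential : ∀ {N} → ℕ → Subset N → ℕ
potential {N} k x = ∑< N (λ t → ∣ x ∩≥ t ∣ ⊓ k)

potential-adjacent : ∀ {N k j} {σ τ : Subset N} → ∣ τ ∣ ≡ suc k → ∣ σ ∩ τ ∣ ≡ k →
                     τ ⊆ interval N j (suc k) → potential k τ ≤ potential k σ + suc k
potential-adjacent {N} {k} {j} {σ} {τ} ∣τ∣≡1+k ∣σ∩τ∣≡k τ⊆ = begin
  potential k τ                                  ≤⟨ ∑<-mono-≤ N termwise ⟩
  ∑< N (λ t → ∣ σ ∩≥ t ∣ ⊓ k + window t)         ≡⟨ ∑<-+ N (λ t → ∣ σ ∩≥ t ∣ ⊓ k) window ⟩
  potential k σ + count N (inRange (suc j) (j + suc k))
    ≤⟨ +-monoʳ-≤ (potential k σ) (count-inRange-≤ N (suc j) (j + suc k)) ⟩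
  potential k σ + (suc (j + suc k) ∸ suc j)      ≡⟨ cong (potential k σ +_) (m+n∸m≡n j (suc k)) ⟩
  potential k σ + suc k                          ∎
  where
  open ≤-Reasoning
  window : ℕ → ℕ
  window t = indicator (inRange (suc j) (j + suc k) t)

  jump : ∀ t → ∣ τ ∩≥ t ∣ ≤ suc ∣ σ ∩≥ t ∣
  jump = ∣∩≥∣-adjacent {σ = σ} {τ} ∣τ∣≡1+k ∣σ∩τ∣≡k

  -- Below the window τ lies entirely above t, so σ already meets the cap k;
  -- above it τ contributes nothing; inside it the count grows by at most one.
  termwise : ∀ t → ∣ τ ∩≥ t ∣ ⊓ k ≤ ∣ σ ∩≥ t ∣ ⊓ k + window t
  termwise t with t ≤? j | j + suc k <? t
  ... | yes t≤j | _ = begin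
    ∣ τ ∩≥ t ∣ ⊓ k                 ≤⟨ m⊓n≤n _ k ⟩
    k                              ≡⟨ m≥n⇒m⊓n≡n k≤σ ⟨
    ∣ σ ∩≥ t ∣ ⊓ k                 ≤⟨ m≤m+n _ (window t) ⟩
    ∣ σ ∩≥ t ∣ ⊓ k + window t      ∎
    where
    k≤σ : k ≤ ∣ σ ∩≥ t ∣
    k≤σ = s≤s⁻¹ (≤-trans (≤-reflexive (sym ∣τ∣≡1+k)) (≤-trans (∣∩≥∣-below τ⊆ t≤j) (jump t)))
  ... | no t≰j | no t≮ = begin
    ∣ τ ∩≥ t ∣ ⊓ k                 ≤⟨ ⊓-mono-≤ (jump t) (n≤1+n k) ⟩
    suc (∣ σ ∩≥ t ∣ ⊓ k)           ≡⟨ +-comm 1 _ ⟩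
    ∣ σ ∩≥ t ∣ ⊓ k + 1             ≡⟨ cong (λ b → ∣ σ ∩≥ t ∣ ⊓ k + indicator b) in-window ⟨
    ∣ σ ∩≥ t ∣ ⊓ k + window t      ∎
    where
    in-window : inRange (suc j) (j + suc k) t ≡ true
    in-window = Equivalence.to T-≡ (inRange⁺ (≰⇒> t≰j) (≮⇒≥ t≮))
  ... | no _ | yes t> rewrite ∣∩≥∣-above τ⊆ t> = z≤n

potential-walk : ∀ {N k σ ρ ℓ} → Walk N (suc k) σ ρ ℓ →
                 potential k (proj₁ ρ) ≤ potential k (proj₁ σ) + suc k * ℓ
potential-walk {k = k} {σ} here = m≤m+n (potential k (proj₁ σ)) (suc k * 0)
potential-walk {k = k} {σ , _} {ρ , _} {suc ℓ}
               (step {τ = τ , ∣τ∣≡1+k , _ , _ , τ⊆ , _} ∣σ∩τ∣≡k walk) = begin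
  potential k ρ                                ≤⟨ potential-walk walk ⟩
  potential k τ + suc k * ℓ                    ≤⟨ +-monoˡ-≤ (suc k * ℓ) σ→τ ⟩
  potential k σ + suc k + suc k * ℓ            ≡⟨ +-assoc (potential k σ) (suc k) (suc k * ℓ) ⟩
  potential k σ + (suc k + suc k * ℓ)          ≡⟨ cong (potential k σ +_) (*-suc (suc k) ℓ) ⟨
  potential k σ + suc k * suc ℓ                ∎
  where
  open ≤-Reasoning
  σ→τ : potential k τ ≤ potential k σ + suc k
  σ→τ = potential-adjacent {σ = σ} ∣τ∣≡1+k ∣σ∩τ∣≡k τ⊆

diameter-arithmetic : ∀ k a ℓ → a * k ≤ suc k * ℓ → k * (suc k + a) ≤ suc k * ℓ + suc k * suc k
diameter-arithmetic k a ℓ ak≤dℓ = begin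
  k * (suc k + a)              ≡⟨ *-distribˡ-+ k (suc k) a ⟩
  k * suc k + k * a            ≡⟨ cong (k * suc k +_) (*-comm k a) ⟩
  k * suc k + a * k            ≤⟨ +-mono-≤ (*-monoˡ-≤ (suc k) (n≤1+n k)) ak≤dℓ ⟩
  suc k * suc k + suc k * ℓ    ≡⟨ +-comm (suc k * suc k) (suc k * ℓ) ⟩
  suc k * ℓ + suc k * suc k    ∎
  where open ≤-Reasoning

-- With d = suc k and N = d + suc m, the boundary facets first = {0, …, k} and
-- last = {m + 1, …, N − 1} lie in the facets with indices 0 and m.
module EndFacets (k m : ℕ) where

  N : ℕ
  N = suc k + suc m

  first last : Subset N
  first = interval N 0 k
  last  = interval N (suc m) k

  first-profile : ℕ → ℕ
  first-profile t = (suc k ∸ t) ⊓ k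

  ∣first∩≥∣ : ∀ t → ∣ first ∩≥ t ∣ ≡ suc k ∸ t
  ∣first∩≥∣ t = trans (∣interval∩≥∣ N 0 k t) (cong (_∸ t) (m≥n⇒m⊓n≡n (m≤m+n (suc k) (suc m))))

  N⊓last-end : N ⊓ suc (suc m + k) ≡ N
  N⊓last-end = trans (cong (λ b → N ⊓ suc b) (+-comm (suc m) k)) (⊓-idem N)

  ∣last∩≥∣ : ∀ t → ∣ last ∩≥ t ∣ ≡ N ∸ (suc m ⊔ t)
  ∣last∩≥∣ t = trans (∣interval∩≥∣ N (suc m) k t) (cong (_∸ (suc m ⊔ t)) N⊓last-end)

  first-facet : BFacet N (suc k)
  first-facet = first , ∣first∣ , 0 , m<m+n (suc k) z<s , first⊆ , first-unique
    where
    ∣first∣ : ∣ first ∣ ≡ suc k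
    ∣first∣ = trans (∣interval∣ N 0 k) (m≥n⇒m⊓n≡n (m≤m+n (suc k) (suc m)))
    first⊆ : first ⊆ interval N 0 (suc k)
    first⊆ x∈ = ∈-interval⁺ z≤n (m≤n⇒m≤1+n (proj₂ (∈-interval⁻ {i = 0} {k} x∈)))
    0∈first : Fin.zero ∈ first
    0∈first = ∈-interval⁺ {i = 0} {k} z≤n z≤n
    first-unique : ∀ j → IsFacetIndex N (suc k) j → first ⊆ interval N j (suc k) → j ≡ 0
    first-unique j _ first⊆j = n≤0⇒n≡0 (proj₁ (∈-interval⁻ (first⊆j 0∈first)))

  last-facet : BFacet N (suc k)
  last-facet = last , ∣last∣ , m , s≤s (≤-reflexive m+d≡k+a) , last⊆ , last-unique
    where
    m+d≡k+a : m + suc k ≡ k + suc m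
    m+d≡k+a = trans (+-comm m (suc k)) (sym (+-suc k m))
    ∣last∣ : ∣ last ∣ ≡ suc k
    ∣last∣ = trans (∣interval∣ N (suc m) k)
                   (trans (cong (_∸ suc m) N⊓last-end) (m+n∸n≡m (suc k) (suc m)))
    last⊆ : last ⊆ interval N m (suc k)
    last⊆ x∈ with a≤x , x≤a+k ← ∈-interval⁻ {i = suc m} {k} x∈ =
      ∈-interval⁺ (≤-trans (n≤1+n m) a≤x) (≤-trans x≤a+k (≤-reflexive (sym (+-suc m k))))
    top : Fin N
    top = fromℕ (k + suc m)
    top∈last : top ∈ last
    top∈last = ∈-interval⁺ (≤-trans (m≤n+m (suc m) k) (≤-reflexive (sym (toℕ-fromℕ _))))
                           (≤-reflexive (trans (toℕ-fromℕ _) (+-comm k (suc m))))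
    last-unique : ∀ j → IsFacetIndex N (suc k) j → last ⊆ interval N j (suc k) → j ≡ m
    last-unique j j+d<N last⊆j = +-cancelʳ-≡ (suc k) j m (trans j+d≡k+a (sym m+d≡k+a))
      where
      k+a≤j+d : k + suc m ≤ j + suc k
      k+a≤j+d = ≤-trans (≤-reflexive (sym (toℕ-fromℕ _))) (proj₂ (∈-interval⁻ (last⊆j top∈last)))
      j+d≡k+a : j + suc k ≡ k + suc m
      j+d≡k+a = ≤-antisym (s≤s⁻¹ j+d<N) k+a≤j+d

  potential-first : potential k first ≡ ∑< (suc k) first-profile
  potential-first = begin
    ∑< N (λ t → ∣ first ∩≥ t ∣ ⊓ k)
      ≡⟨ ∑<-cong N (λ {t} _ → cong (_⊓ k) (∣first∩≥∣ t)) ⟩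
    ∑< (suc k + suc m) first-profile
      ≡⟨ ∑<-split (suc k) (suc m) first-profile ⟩
    ∑< (suc k) first-profile + ∑< (suc m) (λ t → first-profile (suc k + t))
      ≡⟨ cong (∑< (suc k) first-profile +_) (∑<-cong (suc m) (λ {t} _ → profile-vanishes t)) ⟩
    ∑< (suc k) first-profile + ∑< (suc m) (λ _ → 0)
      ≡⟨ cong (∑< (suc k) first-profile +_) (trans (∑<-const (suc m) 0) (*-zeroʳ (suc m))) ⟩
    ∑< (suc k) first-profile + 0
      ≡⟨ +-identityʳ _ ⟩
    ∑< (suc k) first-profile ∎
    where
    open ≡-Reasoning
    profile-vanishes : ∀ t → first-profile (suc k + t) ≡ 0
    profile-vanishes t = cong (_⊓ k) (m≤n⇒m∸n≡0 (m≤m+n (suc k) t))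

  potential-last : potential k last ≡ suc m * k + ∑< (suc k) first-profile
  potential-last = begin
    ∑< N g
      ≡⟨ cong (λ n → ∑< n g) (+-comm (suc k) (suc m)) ⟩
    ∑< (suc m + suc k) g
      ≡⟨ ∑<-split (suc m) (suc k) g ⟩
    ∑< (suc m) g + ∑< (suc k) (λ t → g (suc m + t))
      ≡⟨ cong₂ _+_ (∑<-cong (suc m) g-full) (∑<-cong (suc k) (λ {t} _ → g-shift t)) ⟩
    ∑< (suc m) (λ _ → k) + ∑< (suc k) first-profile
      ≡⟨ cong (_+ ∑< (suc k) first-profile) (∑<-const (suc m) k) ⟩
    suc m * k + ∑< (suc k) first-profile ∎
    where
    open ≡-Reasoning
    g : ℕ → ℕ
    g t = ∣ last ∩≥ t ∣ ⊓ k
    g-full : ∀ {t} → t < suc m → g t ≡ k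
    g-full {t} t<a = begin
      ∣ last ∩≥ t ∣ ⊓ k        ≡⟨ cong (_⊓ k) (∣last∩≥∣ t) ⟩
      (N ∸ (suc m ⊔ t)) ⊓ k    ≡⟨ cong (λ b → (N ∸ b) ⊓ k) (m≥n⇒m⊔n≡m (<⇒≤ t<a)) ⟩
      (N ∸ suc m) ⊓ k          ≡⟨ cong (_⊓ k) (m+n∸n≡m (suc k) (suc m)) ⟩
      suc k ⊓ k                ≡⟨ m≥n⇒m⊓n≡n (n≤1+n k) ⟩
      k                        ∎
    g-shift : ∀ t → g (suc m + t) ≡ first-profile t
    g-shift t = begin
      ∣ last ∩≥ suc m + t ∣ ⊓ k             ≡⟨ cong (_⊓ k) (∣last∩≥∣ (suc m + t)) ⟩
      (N ∸ (suc m ⊔ (suc m + t))) ⊓ k       ≡⟨ cong (λ b → (N ∸ b) ⊓ k) (m≤n⇒m⊔n≡n (m≤m+n (suc m) t)) ⟩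
      (N ∸ (suc m + t)) ⊓ k                 ≡⟨ cong (λ n → (n ∸ (suc m + t)) ⊓ k) (+-comm (suc k) (suc m)) ⟩
      ((suc m + suc k) ∸ (suc m + t)) ⊓ k   ≡⟨ cong (_⊓ k) ([m+n]∸[m+o]≡n∸o (suc m) (suc k) t) ⟩
      first-profile t                       ∎

  walk-length : ∀ {ℓ} → Walk N (suc k) first-facet last-facet ℓ → suc m * k ≤ suc k * ℓ
  walk-length {ℓ} walk = +-cancelʳ-≤ S _ _ (begin
    suc m * k + S                    ≡⟨ potential-last ⟨
    potential k last                 ≤⟨ potential-walk walk ⟩
    potential k first + suc k * ℓ    ≡⟨ cong (_+ suc k * ℓ) potential-first ⟩
    S + suc k * ℓ                    ≡⟨ +-comm S (suc k * ℓ) ⟩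
    suc k * ℓ + S                    ∎)
    where
    open ≤-Reasoning
    S : ℕ
    S = ∑< (suc k) first-profile

  diameter-bound : DiameterAtLeastBound N (suc k)
  diameter-bound = first-facet , last-facet ,
                   λ ℓ walk → diameter-arithmetic k (suc m) ℓ (walk-length walk)

-- The argument only needs d ≥ 1.
lemma2 : (d N : ℕ) → 2 ≤ d → d + 1 ≤ N → DiameterAtLeastBound N d
lemma2 zero    N () _
lemma2 (suc k) N _ d+1≤N with m , d+1+m≡N ← m≤n⇒∃[o]m+o≡n d+1≤N =
  subst (λ n → DiameterAtLeastBound n (suc k))
        (trans (sym (+-assoc (suc k) 1 m)) d+1+m≡N)
        (EndFacets.diameter-bound k m)
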